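{- Let $G$ be a connected graph and let $f$ be an extremal MC-coloring of $G$. Then for every color $i$ used by $f$ on at least two edges, among the vertices incident to edges of color $i$ there exist two vertices that are nonadjacent in $G$.
   Context: All graphs are finite, simple and undirected. For a connected graph $G$, an edge-coloring of $G$ (adjacent edges may receive the same color) is a monochromatic connection coloring (MC-coloring) if any two vertices of $G$ are joined by a path all of whose edges have the same color. The monochromatic connection number $mc(G)$ is the maximum number of colors used in an MC-coloring of $G$, and an MC-coloring is extremal if it uses exactly $mc(G)$ colors. -}

module Defs where

open import Data.Nat using (ℕ; _≤_)
open import Data.Fin using (Fin)
open import Data.Bool using (Bool; true; false; T)
open import Data.List using (List; []; _∷_)
open import Data.List.Relation.Unary.Unique.Propositional using (Unique)
open import Data.Product using (proj₁; Σ; ∃; ∃-syntax; _×_; _,_)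
open import Data.Unit using (⊤)
open import Relation.Binary.PropositionalEquality using (_≡_)

record Graph (n : ℕ) : Set where
  field
    adj    : Fin n → Fin n → Bool
    sym    : ∀ u v → adj u v ≡ adj v u
    irrefl : ∀ u → adj u u ≡ false

open Graph public

module _ {n : ℕ} (G : Graph n) where

  Adj : Fin n → Fin n → Set
  Adj u v = T (adj G u v)

  data Walk (P : (a b : Fin n) → Adj a b → Set) : Fin n → Fin n → List (Fin n) → Set where
    here : ∀ {u} → Walk P u u (u ∷ [])
    step : ∀ {u v w vs} (p : Adj u v) → P u v p → Walk P v w vs → Walk P u w (u ∷ vs)

  PathWith : ((a b : Fin n) → Adj a b → Set) → Fin n → Fin n → Set
  PathWith P u v = ∃[ vs ] (Walk P u v vs × Unique vs)

  Connected : Set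
  Connected = ∀ u v → PathWith (λ _ _ _ → ⊤) u v

  EdgeColoring : ℕ → Set
  EdgeColoring k = Σ ((u v : Fin n) → Adj u v → Fin k)
                     (λ f → ∀ u v (p : Adj u v) (q : Adj v u) → f u v p ≡ f v u q)

  module _ {k : ℕ} (c : EdgeColoring k) where
    col : (u v : Fin n) → Adj u v → Fin k
    col = proj₁ c

    UsesAllColors : Set
    UsesAllColors = ∀ (i : Fin k) → ∃[ u ] ∃[ v ] Σ (Adj u v) (λ p → col u v p ≡ i)

    IsMC : Set
    IsMC = ∀ u v → ∃[ i ] PathWith (λ a b p → col a b p ≡ i) u v

  -- f is an extremal MC-colouring: MC, uses exactly k colours, and no
  -- MC-colouring uses more than k colours (so k = mc(G)).
  IsExtremalMC : {k : ℕ} → EdgeColoring k → Set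
  IsExtremalMC {k} c =
    IsMC c × UsesAllColors c ×
    (∀ (k' : ℕ) (g : EdgeColoring k') → IsMC g → UsesAllColors g → k' ≤ k)

-- If the vertices incident to colour i were pairwise adjacent, every two of
-- them would be joined by a single edge; so a colour-i edge {u,v} could be
-- given a brand-new colour: pairs formerly joined by colour i are now joined
-- by the edge between them, and paths of other colours never use {u,v}.
-- Since a second colour-i edge keeps colour i alive, the new colouring is an
-- MC-colouring with one colour more, contradicting extremality.
module Submission where

open import Defs hiding (sym)
open import Data.Nat using (ℕ; suc)
open import Data.Nat.Properties using (1+n≰n)
open import Data.Fin using (Fin; zero; suc; _≟_)
open import Data.Fin.Properties using (any?)
open import Data.Bool using (true; false; T)
open import Data.Bool.Properties using (T-irrelevant) renaming (_≟_ to _≟ᵇ_)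
open import Data.Product using (Σ; ∃-syntax; _×_; _,_; proj₂)
open import Data.Sum using (_⊎_; inj₁; inj₂)
open import Data.Empty using (⊥-elim)
open import Data.List using (List; []; _∷_)
open import Data.List.Relation.Unary.All using ([]; _∷_)
open import Data.List.Relation.Unary.AllPairs using ([]; _∷_)
open import Relation.Binary.PropositionalEquality using (_≡_; _≢_; refl; sym; trans; subst; cong)
open import Relation.Nullary using (¬_; Dec; yes; no)
open import Relation.Nullary.Decidable using (_×-dec_; _⊎-dec_; ¬?; T?)

SameEdge : ∀ {n} → (u v x y : Fin n) → Set
SameEdge u v x y = (u ≡ x × v ≡ y) ⊎ (u ≡ y × v ≡ x)

sameEdge? : ∀ {n} (u v x y : Fin n) → Dec (SameEdge u v x y)
sameEdge? u v x y = ((u ≟ x) ×-dec (v ≟ y)) ⊎-dec ((u ≟ y) ×-dec (v ≟ x))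

SameEdge-swap : ∀ {n} {u v x y : Fin n} → SameEdge u v x y → SameEdge v u x y
SameEdge-swap (inj₁ (u≡x , v≡y)) = inj₂ (v≡y , u≡x)
SameEdge-swap (inj₂ (u≡y , v≡x)) = inj₁ (v≡x , u≡y)

module _ {n : ℕ} (G : Graph n) where

  Adj-sym : ∀ {u v} → Adj G u v → Adj G v u
  Adj-sym {u} {v} = subst T (Graph.sym G u v)

  Walk-map : ∀ {P R : (a b : Fin n) → Adj G a b → Set} →
             (∀ {a b} (p : Adj G a b) → P a b p → R a b p) →
             ∀ {x y vs} → Walk G P x y vs → Walk G R x y vs
  Walk-map h here         = here
  Walk-map h (step p c w) = step p (h p c) (Walk-map h w)

  module _ {k : ℕ} (f : EdgeColoring G k) where

    col-irrelevant : ∀ {u v} (p q : Adj G u v) → col G f u v p ≡ col G f u v q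
    col-irrelevant {u} {v} p q = cong (col G f u v) (T-irrelevant p q)

    col-sym : ∀ {u v} (p : Adj G u v) → col G f v u (Adj-sym p) ≡ col G f u v p
    col-sym {u} {v} p = sym (proj₂ f u v p (Adj-sym p))

    col-sameEdge : ∀ {u v x y} (p : Adj G u v) (q : Adj G x y) →
                   SameEdge u v x y → col G f u v p ≡ col G f x y q
    col-sameEdge p q (inj₁ (refl , refl)) = col-irrelevant p q
    col-sameEdge p q (inj₂ (refl , refl)) = trans (col-irrelevant p (Adj-sym q)) (col-sym q)

    Incident : Fin k → Fin n → Set
    Incident i x = ∃[ x' ] Σ (Adj G x x') (λ p → col G f x x' p ≡ i)

    incident? : ∀ i x → Dec (Incident i x)
    incident? i x = any? edgeTo?
      where
      edgeTo? : ∀ x' → Dec (Σ (Adj G x x') (λ p → col G f x x' p ≡ i))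
      edgeTo? x' with T? (adj G x x')
      ... | no ¬p = no λ (p , _) → ¬p p
      ... | yes p with col G f x x' p ≟ i
      ...   | yes c = yes (p , c)
      ...   | no ¬c = no λ (q , c) → ¬c (trans (col-irrelevant p q) c)

    MonoWalk : Fin k → Fin n → Fin n → List (Fin n) → Set
    MonoWalk i = Walk G (λ a b p → col G f a b p ≡ i)

    MonoWalk-source-incident : ∀ {i x y vs} → MonoWalk i x y vs → x ≢ y → Incident i x
    MonoWalk-source-incident here         x≢x = ⊥-elim (x≢x refl)
    MonoWalk-source-incident (step p c _) _   = _ , p , c

    MonoWalk-target-incident : ∀ {i x y vs} → MonoWalk i x y vs → x ≢ y → Incident i y
    MonoWalk-target-incident here x≢x = ⊥-elim (x≢x refl)
    MonoWalk-target-incident {x = x} {y} (step {v = v} p c w) _ with v ≟ y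
    ... | yes refl = x , Adj-sym p , trans (col-sym p) c
    ... | no v≢y   = MonoWalk-target-incident w v≢y

    IncidentClique : Fin k → Set
    IncidentClique i = ∀ x y → Incident i x → Incident i y → x ≢ y → Adj G x y

    NonadjacentIncidentPair : Fin k → Set
    NonadjacentIncidentPair i =
      ∃[ x ] ∃[ y ] Incident i x × Incident i y × x ≢ y × adj G x y ≡ false

    nonadjacentIncidentPair-or-incidentClique :
      ∀ i → NonadjacentIncidentPair i ⊎ IncidentClique i
    nonadjacentIncidentPair-or-incidentClique i with any? (λ x → any? (λ y → pair? x y))
      where
      pair? : ∀ x y → Dec (Incident i x × Incident i y × x ≢ y × adj G x y ≡ false)
      pair? x y = incident? i x ×-dec incident? i y ×-dec ¬? (x ≟ y) ×-dec (adj G x y ≟ᵇ false)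
    ... | yes pair = inj₁ pair
    ... | no ¬pair = inj₂ clique
      where
      clique : IncidentClique i
      clique x y ix iy x≢y with adj G x y in xy
      ... | true  = _
      ... | false = ⊥-elim (¬pair (x , y , ix , iy , x≢y , xy))

    module Recolour (u₀ v₀ : Fin n) where

      recolourAt : ∀ {u v} → Dec (SameEdge u v u₀ v₀) → Fin k → Fin (suc k)
      recolourAt (yes _) _ = zero
      recolourAt (no _)  j = suc j

      recolour : EdgeColoring G (suc k)
      recolour = (λ u v p → recolourAt (sameEdge? u v u₀ v₀) (col G f u v p)) , symmetric
        where
        symmetric : ∀ u v (p : Adj G u v) (q : Adj G v u) →
                    recolourAt (sameEdge? u v u₀ v₀) (col G f u v p) ≡
                    recolourAt (sameEdge? v u u₀ v₀) (col G f v u q)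
        symmetric u v p q with sameEdge? u v u₀ v₀ | sameEdge? v u u₀ v₀
        ... | yes _ | yes _  = refl
        ... | no _  | no _   = cong suc (proj₂ f u v p q)
        ... | yes e | no ¬e  = ⊥-elim (¬e (SameEdge-swap e))
        ... | no ¬e | yes e  = ⊥-elim (¬e (SameEdge-swap e))

      recolour-fresh : ∀ {u v} (p : Adj G u v) → SameEdge u v u₀ v₀ → col G recolour u v p ≡ zero
      recolour-fresh {u} {v} p e with sameEdge? u v u₀ v₀
      ... | yes _ = refl
      ... | no ¬e = ⊥-elim (¬e e)

      recolour-old : ∀ {u v} (p : Adj G u v) → ¬ SameEdge u v u₀ v₀ →
                     col G recolour u v p ≡ suc (col G f u v p)
      recolour-old {u} {v} p ¬e with sameEdge? u v u₀ v₀
      ... | yes e = ⊥-elim (¬e e)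
      ... | no _  = refl

      module _ {i : Fin k} (p₀ : Adj G u₀ v₀) (c₀ : col G f u₀ v₀ p₀ ≡ i) where

        recolour-isMC : IncidentClique i → IsMC G f → IsMC G recolour
        recolour-isMC clique mc x y with mc x y
        ... | j , vs , w , unique with j ≟ i
        ...   | no j≢i = suc j , vs , Walk-map shift w , unique
          where
          shift : ∀ {a b} (p : Adj G a b) → col G f a b p ≡ j → col G recolour a b p ≡ suc j
          shift p c = trans (recolour-old p λ e → j≢i (trans (sym c) (trans (col-sameEdge p p₀ e) c₀)))
                            (cong suc c)
        ...   | yes refl with x ≟ y
        ...     | yes refl = zero , x ∷ [] , here , [] ∷ []
        ...     | no x≢y   = col G recolour x y p , x ∷ y ∷ [] , step p refl here , (x≢y ∷ []) ∷ [] ∷ []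
          where
          p : Adj G x y
          p = clique x y (MonoWalk-source-incident w x≢y) (MonoWalk-target-incident w x≢y) x≢y

        recolour-usesAllColors : ∀ {u v} (p : Adj G u v) → col G f u v p ≡ i →
                                 ¬ SameEdge u v u₀ v₀ →
                                 UsesAllColors G f → UsesAllColors G recolour
        recolour-usesAllColors _ _ _ _ zero = u₀ , v₀ , p₀ , recolour-fresh p₀ (inj₁ (refl , refl))
        recolour-usesAllColors {u} {v} p c ¬e all (suc j) with all j
        ... | a , b , q , d with sameEdge? a b u₀ v₀
        ...   | no ¬e′ = a , b , q , trans (recolour-old q ¬e′) (cong suc d)
        ...   | yes e′ = u , v , p , trans (recolour-old p ¬e) (cong suc (trans c i≡j))
          where
          -- the only edge losing its colour j had colour i, so j = i is still carried by {u,v}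
          i≡j : i ≡ j
          i≡j = trans (sym c₀) (trans (sym (col-sameEdge q p₀ e′)) d)
  open Recolour public

mainTheorem5 : ∀ {n : ℕ} (G : Graph n) → Connected G →
    ∀ {k : ℕ} (f : EdgeColoring G k) → IsExtremalMC G f →
    ∀ (i : Fin k) →
    (∃[ u₁ ] ∃[ v₁ ] ∃[ u₂ ] ∃[ v₂ ]
       Σ (Adj G u₁ v₁) (λ p₁ → Σ (Adj G u₂ v₂) (λ p₂ →
         col G f u₁ v₁ p₁ ≡ i × col G f u₂ v₂ p₂ ≡ i ×
         ¬ ((u₁ ≡ u₂ × v₁ ≡ v₂) ⊎ (u₁ ≡ v₂ × v₁ ≡ u₂))))) →
    ∃[ x ] ∃[ y ]
      (∃[ x' ] Σ (Adj G x x') (λ p → col G f x x' p ≡ i)) ×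
      (∃[ y' ] Σ (Adj G y y') (λ q → col G f y y' q ≡ i)) ×
      x ≢ y × adj G x y ≡ false
mainTheorem5 G _ {k} f (mc , all , maximal) i (u₁ , v₁ , u₂ , v₂ , p₁ , p₂ , c₁ , c₂ , distinct)
  with nonadjacentIncidentPair-or-incidentClique G f i
... | inj₁ pair   = pair
... | inj₂ clique = ⊥-elim (1+n≰n (maximal (suc k) (recolour G f u₂ v₂)
                      (recolour-isMC G f u₂ v₂ p₂ c₂ clique mc)
                      (recolour-usesAllColors G f u₂ v₂ p₂ c₂ p₁ c₁ distinct all)))
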